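{- Let $p$ be a prime, $k\ge2$, $A=\mathbb{Z}_p^k$, and let $T$ be a caterpillar with spine path $s_1s_2s_3$, where $X,Y,Z$ are the sets of leaves attached to $s_1,s_2,s_3$ respectively and $|V(T)|=|A|$. Let $\alpha,\beta,\gamma\in\{0,\dots,p-1\}$ be the residues of $|X|,|Y|,|Z|$ modulo $p$, with $\alpha+\beta+\gamma\equiv p-3\pmod p$. If $T$ has an $A$-rainbow labeling $f$ with $f(s_1)=a$, $f(s_2)=0$, $f(s_3)=b$ and $b\notin\langle a\rangle$, then $|Y|\ge p-1$.
   Context: For an Abelian group $A$ and a tree $T$ with $|V(T)|=|A|$, a labeling $f\colon V(T)\to A$ induces the edge labeling $uv\mapsto f(u)+f(v)$; $f$ is an $A$-rainbow labeling if $f$ is a bijection and all edges receive distinct labels. $\langle a\rangle$ is the subgroup generated by $a$. -}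

module Defs where

open import Data.Nat using (ℕ; zero; suc; _+_)
open import Data.Nat.DivMod using (_mod_; _%_)
open import Data.Nat.Primality using (Prime; prime⇒nonZero)
open import Data.Fin using (Fin; toℕ)
open import Data.Vec using (Vec; zipWith; replicate)
open import Data.Product using (∃; _×_)
open import Data.Empty using (⊥)
open import Relation.Nullary using (¬_)
open import Relation.Binary.PropositionalEquality using (_≡_)
open import Function.Definitions using (Injective; Bijective)

_+ₚ_ : ∀ {p} → Fin p → Fin p → Fin p
_+ₚ_ {suc n} a b = (toℕ a + toℕ b) mod suc n

A : ℕ → ℕ → Set
A p k = Vec (Fin p) k

_⊕_ : ∀ {p k} → A p k → A p k → A p k
_⊕_ = zipWith _+ₚ_

zeroA : (p k : ℕ) → Prime p → A p k
zeroA p k pp = replicate k (0 mod p)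
  where instance _ = prime⇒nonZero pp

mulA : (p k : ℕ) → Prime p → ℕ → A p k → A p k
mulA p k pp zero    a = zeroA p k pp
mulA p k pp (suc n) a = a ⊕ mulA p k pp n a

-- Membership in the cyclic subgroup ⟨a⟩ (in a finite group, ⟨a⟩ = {n·a : n ∈ ℕ}).
_∈⟨_⟩ : ∀ {p k} {pp : Prime p} → A p k → A p k → Set
_∈⟨_⟩ {p} {k} {pp} b a = ∃ λ n → b ≡ mulA p k pp n a

data Vtx (x y z : ℕ) : Set where
  s₁ s₂ s₃ : Vtx x y z
  leafX : Fin x → Vtx x y z
  leafY : Fin y → Vtx x y z
  leafZ : Fin z → Vtx x y z

data Edge (x y z : ℕ) : Set where
  e₁₂ e₂₃ : Edge x y z
  eX : Fin x → Edge x y z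
  eY : Fin y → Edge x y z
  eZ : Fin z → Edge x y z

edgeLabel : ∀ {p k x y z} → (Vtx x y z → A p k) → Edge x y z → A p k
edgeLabel f e₁₂    = f s₁ ⊕ f s₂
edgeLabel f e₂₃    = f s₂ ⊕ f s₃
edgeLabel f (eX i) = f s₁ ⊕ f (leafX i)
edgeLabel f (eY i) = f s₂ ⊕ f (leafY i)
edgeLabel f (eZ i) = f s₃ ⊕ f (leafZ i)

IsRainbow : ∀ {p k x y z} → (Vtx x y z → A p k) → Set
IsRainbow f = Bijective _≡_ _≡_ f × Injective _≡_ _≡_ (edgeLabel f)

residue : (p : ℕ) → Prime p → ℕ → ℕ
residue p pp n = n % p
  where instance _ = prime⇒nonZero pp

-- Let a = f(s₁), b = f(s₃) and c = b − a. In ℤ_p^k every nonzero element has order p, and b ∉ ⟨a⟩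
-- forces ⟨a⟩ ∩ ⟨c⟩ = {0}; hence for each u at most one i < p has u + i·a ∈ ⟨c⟩.
-- Fix j < p − 1 and suppose that no leaf l ∈ Y has f(l) + j·a ∈ ⟨c⟩. Consider the band
-- W = ⟨c⟩ − {0, …, j}·a. Send each vertex v ≠ s₂ to ℓ(v) − a, where ℓ(v) is the label of the edge
-- from v towards s₂, if this lies in W, and to f(v) otherwise; send s₂ to a and one extra point to b.
-- Since edge labels are distinct, f is injective, a, b ∉ W, and f(v) ∈ W implies ℓ(v) − a ∈ W for every
-- v ∉ {s₁, s₂, s₃} (this is where the assumption on the leaves of Y enters), the map is an injection
-- V(T) + 1 → A, contradicting |V(T)| = |A|. So each j < p − 1 is realised by a leaf of Y, and distinct
-- j by distinct leaves.

module Submission where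

open import Defs
open import Data.Nat using (ℕ; _+_; _≤_; _∸_; _^_)
open import Data.Nat.Divisibility using (_∣_)
open import Data.Nat.Primality using (Prime)
open import Data.Fin using (Fin)
open import Relation.Nullary using (¬_)
open import Relation.Binary.PropositionalEquality using (_≡_)

open import Algebra.Bundles using (AbelianGroup)
open import Algebra.Consequences.Propositional using (comm∧idˡ⇒id; comm∧invˡ⇒inv)
open import Algebra.Core using (Op₁; Op₂)
open import Algebra.Definitions using (Commutative; Associative; LeftIdentity; LeftInverse)
open import Algebra.Structures using (IsAbelianGroup)
import Algebra.Properties.Monoid.Mult as MonoidMult
open import Data.Fin using (zero; suc; toℕ; fromℕ<)
open import Data.Fin.Properties using (toℕ-injective; toℕ-fromℕ<; toℕ<n; any?; +↔⊎; 1↔⊤; injective⇒≤)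
  renaming (_≟_ to _≟ᶠ_)
open import Data.Nat using (NonZero; zero; suc; _*_; _%_; _/_; pred; _<_; s≤s; z≤n)
open import Data.Nat.Coprimality using (Coprime; coprime-Bézout)
open import Data.Nat.DivMod
  using (_mod_; m%n<n; m≡m%n+[m/n]*n; [m+kn]%n≡m%n; %-distribˡ-+; m%n%n≡m%n; n%n≡0; m*n%n≡0; m<n⇒m%n≡m)
open import Data.Nat.Divisibility using (_∤_; divides; _∣?_; >⇒∤)
open import Data.Nat.GCD using (module Bézout)
open import Data.Nat.Primality using (prime⇒nonZero; prime⇒irreducible; ¬prime[0])
open import Data.Nat.Properties
  using (<-cmp; m<n⇒m<1+n; m+[n∸m]≡n; m∸n+n≡m; m∸n≡0⇒m≤n; m∸n≤m; ≤-<-trans; <⇒≱; <⇒≤; ≤-pred; m≤n⇒m<n∨m≡n;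
         1+n≰n; +-comm; +-assoc; *-comm; suc-pred)
open import Data.Nat.Tactic.RingSolver using (solve-∀)
open import Data.Product using (∃; _,_; proj₁; proj₂)
open import Data.Sum using (_⊎_; inj₁; inj₂)
open import Data.Sum.Algebra using (⊎-comm)
open import Data.Sum.Function.Propositional using (_⊎-cong_)
open import Data.Unit using (⊤)
open import Data.Vec using ([]; _∷_; replicate; map)
open import Data.Vec.Properties using (zipWith-assoc; zipWith-comm; zipWith-identityˡ; zipWith-inverseˡ; ≡-dec)
open import Function.Bundles using (_↔_; _↣_; mk↣; mk⤖; mk↔ₛ′; Injection)
open import Function.Construct.Composition using (_↣-∘_)
open import Function.Related.Propositional using (module EquationalReasoning)
open import Function.Definitions using (Injective)
open import Function.Properties.Bijection using (⤖⇒↔)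
open import Function.Properties.Inverse using (↔-sym; ↔-refl; ↔⇒↣)
open import Level using (0ℓ)
open import Relation.Binary.Definitions as B using (tri<; tri≈; tri>)
import Relation.Binary.PropositionalEquality as ≡
open ≡ using (_≢_)
open import Relation.Binary.PropositionalEquality.Algebra using (isMagma)
open import Relation.Nullary using (yes; no; contradiction)
open import Relation.Nullary.Decidable using (map′)
open import Relation.Unary using (Pred; _∈_; _∉_; Decidable)

prime∧∤⇒coprime : ∀ {p n} → Prime p → p ∤ n → Coprime p n
prime∧∤⇒coprime p-prime p∤n (d∣p , d∣n) with prime⇒irreducible p-prime d∣p
... | inj₁ d≡1    = d≡1
... | inj₂ ≡.refl = contradiction d∣n p∤n

∤⇒inverse-mod : ∀ {p e} .{{_ : NonZero p}} → Prime p → p ∤ e → ∃ λ e' → (e' * e) % p ≡ 1 % p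
∤⇒inverse-mod {suc q} {e} p-prime p∤e with coprime-Bézout (prime∧∤⇒coprime p-prime p∤e)
... | Bézout.-+ x y 1+xp≡ye = y , (begin
  (y * e) % suc q          ≡⟨ ≡.cong (_% suc q) 1+xp≡ye ⟨
  (1 + x * suc q) % suc q  ≡⟨ [m+kn]%n≡m%n 1 x (suc q) ⟩
  1 % suc q                ∎)
  where open ≡.≡-Reasoning
-- Here y * e ≡ -1 (mod p), so (p - 1) * y inverts e.
... | Bézout.+- x y 1+ye≡xp = q * y , (begin
  (q * y * e) % suc q                  ≡⟨ [m+kn]%n≡m%n (q * y * e) x (suc q) ⟨
  (q * y * e + x * suc q) % suc q      ≡⟨ ≡.cong (λ r → (q * y * e + r) % suc q) 1+ye≡xp ⟨
  (q * y * e + (1 + y * e)) % suc q    ≡⟨ ≡.cong (_% suc q) (rearrange q y e) ⟩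
  (1 + y * e * suc q) % suc q          ≡⟨ [m+kn]%n≡m%n 1 (y * e) (suc q) ⟩
  1 % suc q                            ∎)
  where
  open ≡.≡-Reasoning
  rearrange : ∀ q y e → q * y * e + (1 + y * e) ≡ 1 + y * e * suc q
  rearrange = solve-∀

module Cyclic {c ℓ} (G : AbelianGroup c ℓ) where

  open AbelianGroup G
  open import Algebra.Properties.AbelianGroup G using (xyx⁻¹≈y)
  open import Algebra.Properties.Group group using (inverseʳ-unique; //-rightDividesˡ)
  open import Algebra.Properties.CommutativeMonoid.Mult commutativeMonoid public using (_×_)
  open import Algebra.Properties.CommutativeMonoid.Mult commutativeMonoid
    using (×-congʳ; ×-congˡ; ×-homo-1; ×-homo-+; ×-assocˡ; ×-distrib-+)
  open import Relation.Binary.Reasoning.Setoid setoid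

  ⟨_⟩ : Carrier → Pred Carrier ℓ
  ⟨ g ⟩ x = ∃ λ n → x ≈ n × g

  ×-ε : ∀ n → n × ε ≈ ε
  ×-ε zero    = refl
  ×-ε (suc n) = trans (∙-congˡ (×-ε n)) (identityˡ ε)

  ∈⟨⟩-resp-≈ : ∀ {g x y} → x ≈ y → x ∈ ⟨ g ⟩ → y ∈ ⟨ g ⟩
  ∈⟨⟩-resp-≈ x≈y (n , x≈ng) = n , trans (sym x≈y) x≈ng

  ∙-∈⟨⟩ : ∀ {g x y} → x ∈ ⟨ g ⟩ → y ∈ ⟨ g ⟩ → x ∙ y ∈ ⟨ g ⟩
  ∙-∈⟨⟩ {g} (m , x≈mg) (n , y≈ng) = m + n , trans (∙-cong x≈mg y≈ng) (sym (×-homo-+ g m n))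

  module PrimeExponent {p : ℕ} (p-prime : Prime p) (exponent : ∀ x → p × x ≈ ε) where

    private instance
      p≢0 : NonZero p
      p≢0 = prime⇒nonZero p-prime

    ∣⇒×≈ε : ∀ {m} → p ∣ m → ∀ x → m × x ≈ ε
    ∣⇒×≈ε (divides t ≡.refl) x = begin
      (t * p) × x  ≈⟨ ×-assocˡ x t p ⟨
      t × (p × x)  ≈⟨ ×-congʳ t (exponent x) ⟩
      t × ε        ≈⟨ ×-ε t ⟩
      ε            ∎

    ×-mod : ∀ m x → m × x ≈ (m % p) × x
    ×-mod m x = begin
      m × x                             ≈⟨ ×-congˡ (m≡m%n+[m/n]*n m p) ⟩
      (m % p + m / p * p) × x           ≈⟨ ×-homo-+ x (m % p) (m / p * p) ⟩
      (m % p) × x ∙ (m / p * p) × x     ≈⟨ ∙-congˡ (∣⇒×≈ε (divides (m / p) ≡.refl) x) ⟩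
      (m % p) × x ∙ ε                   ≈⟨ identityʳ _ ⟩
      (m % p) × x                       ∎

    ×-invertible : ∀ {e} → p ∤ e → ∃ λ e' → ∀ x → e' × (e × x) ≈ x
    ×-invertible {e} p∤e with ∤⇒inverse-mod p-prime p∤e
    ... | e' , e'e≡1 = e' , λ x → begin
      e' × (e × x)        ≈⟨ ×-assocˡ x e' e ⟩
      (e' * e) × x        ≈⟨ ×-mod (e' * e) x ⟩
      ((e' * e) % p) × x  ≡⟨ ≡.cong (_× x) e'e≡1 ⟩
      (1 % p) × x         ≈⟨ ×-mod 1 x ⟨
      1 × x               ≈⟨ ×-homo-1 x ⟩
      x                   ∎

    ×≈ε⇒∣ : ∀ {m a} → a ≉ ε → m × a ≈ ε → p ∣ m
    ×≈ε⇒∣ {m} {a} a≉ε ma≈ε with p ∣? m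
    ... | yes p∣m = p∣m
    ... | no p∤m with ×-invertible p∤m
    ...   | m' , m'm≈id = contradiction (begin
      a             ≈⟨ m'm≈id a ⟨
      m' × (m × a)  ≈⟨ ×-congʳ m' ma≈ε ⟩
      m' × ε        ≈⟨ ×-ε m' ⟩
      ε             ∎) a≉ε

    ⁻¹≈pred-p× : ∀ x → x ⁻¹ ≈ pred p × x
    ⁻¹≈pred-p× x = sym (inverseʳ-unique x (pred p × x) (begin
      x ∙ pred p × x     ≡⟨⟩
      suc (pred p) × x   ≡⟨ ≡.cong (_× x) (suc-pred p) ⟩
      p × x              ≈⟨ exponent x ⟩
      ε                  ∎))

    ⁻¹-∈⟨⟩ : ∀ {g x} → x ∈ ⟨ g ⟩ → x ⁻¹ ∈ ⟨ g ⟩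
    ⁻¹-∈⟨⟩ {g} {x} (n , x≈ng) = pred p * n , (begin
      x ⁻¹             ≈⟨ ⁻¹≈pred-p× x ⟩
      pred p × x       ≈⟨ ×-congʳ (pred p) x≈ng ⟩
      pred p × n × g   ≈⟨ ×-assocˡ g (pred p) n ⟩
      (pred p * n) × g ∎)

    ∈⟨⟩-cancelˡ : ∀ {g x y} → x ∈ ⟨ g ⟩ → x ∙ y ∈ ⟨ g ⟩ → y ∈ ⟨ g ⟩
    ∈⟨⟩-cancelˡ {x = x} {y} x∈ xy∈ = ∈⟨⟩-resp-≈ (xyx⁻¹≈y x y) (∙-∈⟨⟩ xy∈ (⁻¹-∈⟨⟩ x∈))

    ∈⟨⟩? : B.Decidable _≈_ → ∀ g → Decidable ⟨ g ⟩
    ∈⟨⟩? _≈?_ g x = map′ (λ (i , x≈ig) → toℕ i , x≈ig) bounded (any? λ (i : Fin p) → x ≈? (toℕ i × g))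
      where
      bounded : x ∈ ⟨ g ⟩ → ∃ λ (i : Fin p) → x ≈ toℕ i × g
      bounded (n , x≈ng) = n mod p , (begin
        x                      ≈⟨ x≈ng ⟩
        n × g                  ≈⟨ ×-mod n g ⟩
        (n % p) × g            ≡⟨ ≡.cong (_× g) (toℕ-fromℕ< (m%n<n n p)) ⟨
        toℕ (n mod p) × g      ∎)

    -- If m·a = e·(b − a) then e·b = (m + e)·a; as b ∉ ⟨a⟩ this forces p ∣ e, and then m·a = ε.
    ×∈⟨b-a⟩⇒∣ : ∀ {a b m} → a ≉ ε → b ∉ ⟨ a ⟩ → m × a ∈ ⟨ b - a ⟩ → p ∣ m
    ×∈⟨b-a⟩⇒∣ {a} {b} {m} a≉ε b∉⟨a⟩ (e , ma≈e[b-a]) with p ∣? e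
    ... | yes p∣e = ×≈ε⇒∣ a≉ε (trans ma≈e[b-a] (∣⇒×≈ε p∣e (b - a)))
    ... | no p∤e with ×-invertible p∤e
    ...   | e' , e'e≈id = contradiction (e' * (m + e) , (begin
      b                  ≈⟨ e'e≈id b ⟨
      e' × e × b         ≈⟨ ×-congʳ e' eb≈[m+e]a ⟩
      e' × (m + e) × a   ≈⟨ ×-assocˡ a e' (m + e) ⟩
      (e' * (m + e)) × a ∎)) b∉⟨a⟩
      where
      eb≈[m+e]a : e × b ≈ (m + e) × a
      eb≈[m+e]a = begin
        e × b                ≈⟨ ×-congʳ e (//-rightDividesˡ a b) ⟨
        e × ((b - a) ∙ a)    ≈⟨ ×-distrib-+ (b - a) a e ⟩
        e × (b - a) ∙ e × a  ≈⟨ ∙-congʳ ma≈e[b-a] ⟨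
        m × a ∙ e × a        ≈⟨ ×-homo-+ a m e ⟨
        (m + e) × a          ∎

    shift-∉ : ∀ {a b u s t} → a ≉ ε → b ∉ ⟨ a ⟩ → s < t → t < p →
              u ∙ s × a ∈ ⟨ b - a ⟩ → u ∙ t × a ∉ ⟨ b - a ⟩
    shift-∉ {a} {b} {u} {s} {t} a≉ε b∉⟨a⟩ s<t t<p us∈ ut∈ =
      <⇒≱ s<t (m∸n≡0⇒m≤n (∣∧<⇒≡0 p∣t∸s (≤-<-trans (m∸n≤m t s) t<p)))
      where
      split : u ∙ t × a ≈ (u ∙ s × a) ∙ (t ∸ s) × a
      split = begin
        u ∙ t × a                  ≡⟨ ≡.cong (λ n → u ∙ n × a) (m+[n∸m]≡n (<⇒≤ s<t)) ⟨
        u ∙ (s + (t ∸ s)) × a      ≈⟨ ∙-congˡ (×-homo-+ a s (t ∸ s)) ⟩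
        u ∙ (s × a ∙ (t ∸ s) × a)  ≈⟨ assoc u _ _ ⟨
        (u ∙ s × a) ∙ (t ∸ s) × a  ∎

      p∣t∸s : p ∣ t ∸ s
      p∣t∸s = ×∈⟨b-a⟩⇒∣ a≉ε b∉⟨a⟩ (∈⟨⟩-cancelˡ us∈ (∈⟨⟩-resp-≈ split ut∈))

      ∣∧<⇒≡0 : ∀ {n} → p ∣ n → n < p → n ≡ 0
      ∣∧<⇒≡0 {zero}  _   _   = ≡.refl
      ∣∧<⇒≡0 {suc n} p∣n n<p = contradiction p∣n (>⇒∤ n<p)

    shift-unique : ∀ {a b u s t} → a ≉ ε → b ∉ ⟨ a ⟩ → s < p → t < p →
                   u ∙ s × a ∈ ⟨ b - a ⟩ → u ∙ t × a ∈ ⟨ b - a ⟩ → s ≡ t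
    shift-unique {s = s} {t} a≉ε b∉⟨a⟩ s<p t<p us∈ ut∈ with <-cmp s t
    ... | tri< s<t _ _ = contradiction ut∈ (shift-∉ a≉ε b∉⟨a⟩ s<t t<p us∈)
    ... | tri≈ _ s≡t _ = s≡t
    ... | tri> _ _ t<s = contradiction us∈ (shift-∉ a≉ε b∉⟨a⟩ t<s s<p ut∈)

comm∧assoc∧idˡ∧invˡ⇒isAbelianGroup : ∀ {G : Set} {_∙_ : Op₂ G} {ε : G} {_⁻¹ : Op₁ G} →
  Commutative _≡_ _∙_ → Associative _≡_ _∙_ → LeftIdentity _≡_ ε _∙_ → LeftInverse _≡_ ε _⁻¹ _∙_ →
  IsAbelianGroup _≡_ _∙_ ε _⁻¹
comm∧assoc∧idˡ∧invˡ⇒isAbelianGroup {_∙_ = _∙_} {_⁻¹ = _⁻¹} comm assoc idˡ invˡ = record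
  { isGroup = record
    { isMonoid = record
      { isSemigroup = record { isMagma = isMagma _∙_ ; assoc = assoc }
      ; identity = comm∧idˡ⇒id comm idˡ
      }
    ; inverse = comm∧invˡ⇒inv comm invˡ
    ; ⁻¹-cong = ≡.cong _⁻¹
    }
  ; comm = comm
  }

%-absorbˡ : ∀ m n d .{{_ : NonZero d}} → (m % d + n) % d ≡ (m + n) % d
%-absorbˡ m n d = begin
  (m % d + n) % d          ≡⟨ %-distribˡ-+ (m % d) n d ⟩
  (m % d % d + n % d) % d  ≡⟨ ≡.cong (λ r → (r + n % d) % d) (m%n%n≡m%n m d) ⟩
  (m % d + n % d) % d      ≡⟨ %-distribˡ-+ m n d ⟨
  (m + n) % d              ∎
  where open ≡.≡-Reasoning

%-absorbʳ : ∀ m n d .{{_ : NonZero d}} → (m + n % d) % d ≡ (m + n) % d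
%-absorbʳ m n d = begin
  (m + n % d) % d  ≡⟨ ≡.cong (_% d) (+-comm m (n % d)) ⟩
  (n % d + m) % d  ≡⟨ %-absorbˡ n m d ⟩
  (n + m) % d      ≡⟨ ≡.cong (_% d) (+-comm n m) ⟩
  (m + n) % d      ∎
  where open ≡.≡-Reasoning

module ℤₚ (n : ℕ) where

  open ≡ using (refl; cong; cong₂; trans)
  open ≡.≡-Reasoning

  private
    p : ℕ
    p = suc n

  infix 25 -ₚ_
  -ₚ_ : Fin p → Fin p
  -ₚ x = (p ∸ toℕ x) mod p

  toℕ-+ₚ : ∀ (x y : Fin p) → toℕ (x +ₚ y) ≡ (toℕ x + toℕ y) % p
  toℕ-+ₚ x y = toℕ-fromℕ< _

  +ₚ-comm : Commutative _≡_ (_+ₚ_ {p})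
  +ₚ-comm x y = toℕ-injective (begin
    toℕ (x +ₚ y)          ≡⟨ toℕ-+ₚ x y ⟩
    (toℕ x + toℕ y) % p   ≡⟨ cong (_% p) (+-comm (toℕ x) (toℕ y)) ⟩
    (toℕ y + toℕ x) % p   ≡⟨ toℕ-+ₚ y x ⟨
    toℕ (y +ₚ x)          ∎)

  +ₚ-assoc : Associative _≡_ (_+ₚ_ {p})
  +ₚ-assoc x y w = toℕ-injective (begin
    toℕ ((x +ₚ y) +ₚ w)                ≡⟨ toℕ-+ₚ (x +ₚ y) w ⟩
    (toℕ (x +ₚ y) + toℕ w) % p         ≡⟨ cong (λ r → (r + toℕ w) % p) (toℕ-+ₚ x y) ⟩
    ((toℕ x + toℕ y) % p + toℕ w) % p  ≡⟨ %-absorbˡ (toℕ x + toℕ y) (toℕ w) p ⟩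
    (toℕ x + toℕ y + toℕ w) % p        ≡⟨ cong (_% p) (+-assoc (toℕ x) (toℕ y) (toℕ w)) ⟩
    (toℕ x + (toℕ y + toℕ w)) % p      ≡⟨ %-absorbʳ (toℕ x) (toℕ y + toℕ w) p ⟨
    (toℕ x + (toℕ y + toℕ w) % p) % p  ≡⟨ cong (λ r → (toℕ x + r) % p) (toℕ-+ₚ y w) ⟨
    (toℕ x + toℕ (y +ₚ w)) % p         ≡⟨ toℕ-+ₚ x (y +ₚ w) ⟨
    toℕ (x +ₚ (y +ₚ w))                ∎)

  +ₚ-identityˡ : LeftIdentity _≡_ zero (_+ₚ_ {p})
  +ₚ-identityˡ x = toℕ-injective (begin
    toℕ (zero +ₚ x) ≡⟨ toℕ-+ₚ zero x ⟩
    toℕ x % p       ≡⟨ m<n⇒m%n≡m (toℕ<n x) ⟩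
    toℕ x           ∎)

  +ₚ-inverseˡ : LeftInverse _≡_ zero -ₚ_ (_+ₚ_ {p})
  +ₚ-inverseˡ x = toℕ-injective (begin
    toℕ (-ₚ x +ₚ x)                ≡⟨ toℕ-+ₚ (-ₚ x) x ⟩
    (toℕ (-ₚ x) + toℕ x) % p       ≡⟨ cong (λ r → (r + toℕ x) % p) (toℕ-fromℕ< (m%n<n (p ∸ toℕ x) p)) ⟩
    ((p ∸ toℕ x) % p + toℕ x) % p  ≡⟨ %-absorbˡ (p ∸ toℕ x) (toℕ x) p ⟩
    (p ∸ toℕ x + toℕ x) % p        ≡⟨ cong (_% p) (m∸n+n≡m (<⇒≤ (toℕ<n x))) ⟩
    p % p                          ≡⟨ n%n≡0 p ⟩
    0                              ∎)

  ℤₚ-abelianGroup : AbelianGroup 0ℓ 0ℓ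
  ℤₚ-abelianGroup = record
    { _∙_ = _+ₚ_
    ; ε = zero
    ; _⁻¹ = -ₚ_
    ; isAbelianGroup = comm∧assoc∧idˡ∧invˡ⇒isAbelianGroup +ₚ-comm +ₚ-assoc +ₚ-identityˡ +ₚ-inverseˡ
    }

  open MonoidMult (AbelianGroup.monoid ℤₚ-abelianGroup) using (_×_)

  toℕ-× : ∀ (m : ℕ) (x : Fin p) → toℕ (m × x) ≡ (m * toℕ x) % p
  toℕ-× zero    x = refl
  toℕ-× (suc m) x = begin
    toℕ (x +ₚ (m × x))             ≡⟨ toℕ-+ₚ x (m × x) ⟩
    (toℕ x + toℕ (m × x)) % p      ≡⟨ cong (λ r → (toℕ x + r) % p) (toℕ-× m x) ⟩
    (toℕ x + (m * toℕ x) % p) % p  ≡⟨ %-absorbʳ (toℕ x) (m * toℕ x) p ⟩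
    (toℕ x + m * toℕ x) % p        ∎

  p×≡zero : ∀ (x : Fin p) → p × x ≡ zero
  p×≡zero x = toℕ-injective (begin
    toℕ (p × x)      ≡⟨ toℕ-× p x ⟩
    (p * toℕ x) % p  ≡⟨ cong (_% p) (*-comm p (toℕ x)) ⟩
    (toℕ x * p) % p  ≡⟨ m*n%n≡0 (toℕ x) p ⟩
    0                ∎)

  -- Its ε is definitionally zeroA p k _, and its _∙_ is _⊕_.
  A-abelianGroup : ℕ → AbelianGroup 0ℓ 0ℓ
  A-abelianGroup k = record
    { Carrier = A p k
    ; _∙_ = _⊕_
    ; ε = replicate k zero
    ; _⁻¹ = map -ₚ_
    ; isAbelianGroup = comm∧assoc∧idˡ∧invˡ⇒isAbelianGroup
        (zipWith-comm +ₚ-comm) (zipWith-assoc +ₚ-assoc) (zipWith-identityˡ +ₚ-identityˡ) (zipWith-inverseˡ +ₚ-inverseˡ)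
    }

  module _ {k : ℕ} where
    open MonoidMult (AbelianGroup.monoid (A-abelianGroup k)) public
      using () renaming (_×_ to _×ᵥ_)

  ×ᵥ-[] : ∀ (m : ℕ) → m ×ᵥ [] ≡ []
  ×ᵥ-[] zero    = refl
  ×ᵥ-[] (suc m) = cong ([] ⊕_) (×ᵥ-[] m)

  ×ᵥ-∷ : ∀ {k} (m : ℕ) x (u : A p k) → m ×ᵥ (x ∷ u) ≡ (m × x) ∷ (m ×ᵥ u)
  ×ᵥ-∷ zero    x u = refl
  ×ᵥ-∷ (suc m) x u = cong ((x ∷ u) ⊕_) (×ᵥ-∷ m x u)

  p×ᵥ≡ε : ∀ {k} (u : A p k) → p ×ᵥ u ≡ replicate k zero
  p×ᵥ≡ε []      = ×ᵥ-[] p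
  p×ᵥ≡ε (x ∷ u) = trans (×ᵥ-∷ p x u) (cong₂ _∷_ (p×≡zero x) (p×ᵥ≡ε u))

  mulA≡×ᵥ : ∀ {k} (p-prime : Prime p) m (u : A p k) → mulA p k p-prime m u ≡ m ×ᵥ u
  mulA≡×ᵥ p-prime zero    u = refl
  mulA≡×ᵥ p-prime (suc m) u = cong (u ⊕_) (mulA≡×ᵥ p-prime m u)

¬⊎⊤↣ : ∀ {B : Set} {n} → B ↔ Fin n → ¬ ((B ⊎ ⊤) ↣ B)
¬⊎⊤↣ {B} {n} B↔Fin B⊎⊤↣B = 1+n≰n (injective⇒≤ (Injection.injective Fin[1+n]↣Fin[n]))
  where
  Fin[1+n]↔B⊎⊤ : Fin (suc n) ↔ (B ⊎ ⊤)
  Fin[1+n]↔B⊎⊤ =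
    Fin (1 + n)    ↔⟨ +↔⊎ ⟩
    (Fin 1 ⊎ Fin n) ↔⟨ 1↔⊤ ⊎-cong ↔-sym B↔Fin ⟩
    (⊤ ⊎ B)        ↔⟨ ⊎-comm ⊤ B ⟩
    (B ⊎ ⊤)        ∎
    where open EquationalReasoning

  Fin[1+n]↣Fin[n] : Fin (suc n) ↣ Fin n
  Fin[1+n]↣Fin[n] = ↔⇒↣ B↔Fin ↣-∘ (B⊎⊤↣B ↣-∘ ↔⇒↣ Fin[1+n]↔B⊎⊤)

module _ {x y z : ℕ} where

  Vtx↔Fin : Vtx x y z ↔ Fin (3 + (x + (y + z)))
  Vtx↔Fin =
    Vtx x y z                      ↔⟨ mk↔ₛ′ to from to∘from from∘to ⟩
    (Fin 3 ⊎ Fin x ⊎ Fin y ⊎ Fin z) ↔⟨ ↔-refl ⊎-cong ↔-refl ⊎-cong +↔⊎ ⟨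
    (Fin 3 ⊎ Fin x ⊎ Fin (y + z))  ↔⟨ ↔-refl ⊎-cong +↔⊎ ⟨
    (Fin 3 ⊎ Fin (x + (y + z)))    ↔⟨ +↔⊎ ⟨
    Fin (3 + (x + (y + z)))        ∎
    where
    open EquationalReasoning

    to : Vtx x y z → Fin 3 ⊎ Fin x ⊎ Fin y ⊎ Fin z
    to s₁        = inj₁ zero
    to s₂        = inj₁ (suc zero)
    to s₃        = inj₁ (suc (suc zero))
    to (leafX i) = inj₂ (inj₁ i)
    to (leafY i) = inj₂ (inj₂ (inj₁ i))
    to (leafZ i) = inj₂ (inj₂ (inj₂ i))

    from : Fin 3 ⊎ Fin x ⊎ Fin y ⊎ Fin z → Vtx x y z
    from (inj₁ zero)                = s₁
    from (inj₁ (suc zero))          = s₂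
    from (inj₁ (suc (suc zero)))    = s₃
    from (inj₂ (inj₁ i))            = leafX i
    from (inj₂ (inj₂ (inj₁ i)))     = leafY i
    from (inj₂ (inj₂ (inj₂ i)))     = leafZ i

    to∘from : ∀ u → to (from u) ≡ u
    to∘from (inj₁ zero)             = ≡.refl
    to∘from (inj₁ (suc zero))       = ≡.refl
    to∘from (inj₁ (suc (suc zero))) = ≡.refl
    to∘from (inj₂ (inj₁ i))         = ≡.refl
    to∘from (inj₂ (inj₂ (inj₁ i)))  = ≡.refl
    to∘from (inj₂ (inj₂ (inj₂ i)))  = ≡.refl

    from∘to : ∀ v → from (to v) ≡ v
    from∘to s₁        = ≡.refl
    from∘to s₂        = ≡.refl
    from∘to s₃        = ≡.refl
    from∘to (leafX i) = ≡.refl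
    from∘to (leafY i) = ≡.refl
    from∘to (leafZ i) = ≡.refl


  -- The edge joining v to the spine vertex next to it (towards s₂); the value at s₂ is arbitrary.
  edgeOf : Vtx x y z → Edge x y z
  edgeOf s₁        = e₁₂
  edgeOf s₂        = e₁₂
  edgeOf s₃        = e₂₃
  edgeOf (leafX i) = eX i
  edgeOf (leafY i) = eY i
  edgeOf (leafZ i) = eZ i

  vertexOf : Edge x y z → Vtx x y z
  vertexOf e₁₂    = s₁
  vertexOf e₂₃    = s₃
  vertexOf (eX i) = leafX i
  vertexOf (eY i) = leafY i
  vertexOf (eZ i) = leafZ i

  vertexOf∘edgeOf : ∀ {v} → v ≢ s₂ → vertexOf (edgeOf v) ≡ v
  vertexOf∘edgeOf {s₁}      _    = ≡.refl
  vertexOf∘edgeOf {s₂}      v≢s₂ = contradiction ≡.refl v≢s₂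
  vertexOf∘edgeOf {s₃}      _    = ≡.refl
  vertexOf∘edgeOf {leafX i} _    = ≡.refl
  vertexOf∘edgeOf {leafY i} _    = ≡.refl
  vertexOf∘edgeOf {leafZ i} _    = ≡.refl

  edgeOf-injective : ∀ {v w} → v ≢ s₂ → w ≢ s₂ → edgeOf v ≡ edgeOf w → v ≡ w
  edgeOf-injective {v} {w} v≢s₂ w≢s₂ eq = begin
    v                    ≡⟨ vertexOf∘edgeOf v≢s₂ ⟨
    vertexOf (edgeOf v)  ≡⟨ ≡.cong vertexOf eq ⟩
    vertexOf (edgeOf w)  ≡⟨ vertexOf∘edgeOf w≢s₂ ⟩
    w                    ∎
    where open ≡.≡-Reasoning

module Caterpillar {q k x y z : ℕ} (p-prime : Prime (suc q))
  (f : Vtx x y z → A (suc q) k) (rainbow : IsRainbow f)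
  (f[s₂]≡0 : f s₂ ≡ zeroA (suc q) k p-prime)
  (f[s₃]∉⟨f[s₁]⟩ : ¬ (_∈⟨_⟩ {pp = p-prime} (f s₃) (f s₁))) where

  open ℤₚ q using (A-abelianGroup; p×ᵥ≡ε; mulA≡×ᵥ)
  open AbelianGroup (A-abelianGroup k)
  open import Algebra.Properties.AbelianGroup (A-abelianGroup k) using (xyx⁻¹≈y)
  open import Algebra.Properties.Group group using (∙-cancelʳ; //-rightDividesˡ; \\-leftDividesʳ)
  open import Algebra.Properties.CommutativeSemigroup commutativeSemigroup using (xy∙z≈xz∙y)
  open Cyclic (A-abelianGroup k)
  open PrimeExponent p-prime p×ᵥ≡ε
  open ≡.≡-Reasoning

  private
    p : ℕ
    p = suc q

  a b c : A p k
  a = f s₁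
  b = f s₃
  c = b - a

  f-injective : Injective _≡_ _≡_ f
  f-injective = proj₁ (proj₁ rainbow)

  a≢ε : a ≢ ε
  a≢ε a≡ε with f-injective (≡.trans a≡ε (≡.sym f[s₂]≡0))
  ... | ()

  b∉⟨a⟩ : b ∉ ⟨ a ⟩
  b∉⟨a⟩ (n , b≡na) = f[s₃]∉⟨f[s₁]⟩ (n , ≡.trans b≡na (≡.sym (mulA≡×ᵥ p-prime n a)))

  Band : ℕ → Pred (A p k) 0ℓ
  Band j u = ∃ λ (i : Fin (suc j)) → u ∙ toℕ i × a ∈ ⟨ c ⟩

  band? : ∀ j → Decidable (Band j)
  band? j u = any? λ i → ∈⟨⟩? (≡-dec _≟ᶠ_) c (u ∙ toℕ i × a)

  ε∈⟨c⟩ : ε ∈ ⟨ c ⟩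
  ε∈⟨c⟩ = 0 , ≡.refl

  c∈⟨c⟩ : c ∈ ⟨ c ⟩
  c∈⟨c⟩ = 1 , ≡.sym (identityʳ c)

  ∈⟨c⟩⇒band : ∀ {j u} → u ∈ ⟨ c ⟩ → u ∈ Band j
  ∈⟨c⟩⇒band u∈ = zero , ∈⟨⟩-resp-≈ (≡.sym (identityʳ _)) u∈

  ∈⟨c⟩⇒shift-∉ : ∀ {u i} → u ∈ ⟨ c ⟩ → i < q → u ∙ suc i × a ∉ ⟨ c ⟩
  ∈⟨c⟩⇒shift-∉ u∈ i<q = shift-∉ a≢ε b∉⟨a⟩ (s≤s z≤n) (s≤s i<q) (∈⟨⟩-resp-≈ (≡.sym (identityʳ _)) u∈)

  index<q : ∀ {j} → j < q → (i : Fin (suc j)) → toℕ i < q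
  index<q j<q i = ≤-<-trans (≤-pred (toℕ<n i)) j<q

  a∉band : ∀ {j} → j < q → a ∉ Band j
  a∉band j<q (i , a+ia∈) = ∈⟨c⟩⇒shift-∉ ε∈⟨c⟩ (index<q j<q i) (∈⟨⟩-resp-≈ (≡.sym (identityˡ _)) a+ia∈)

  b∉band : ∀ {j} → j < q → b ∉ Band j
  b∉band j<q (i , b+ia∈) = ∈⟨c⟩⇒shift-∉ c∈⟨c⟩ (index<q j<q i) (∈⟨⟩-resp-≈ (≡.sym c∙[a∙ia]≡b∙ia) b+ia∈)
    where
    c∙[a∙ia]≡b∙ia : c ∙ (a ∙ toℕ i × a) ≡ b ∙ toℕ i × a
    c∙[a∙ia]≡b∙ia = begin
      c ∙ (a ∙ toℕ i × a)  ≡⟨ assoc c a _ ⟨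
      (c ∙ a) ∙ toℕ i × a  ≡⟨ ≡.cong (_∙ toℕ i × a) (//-rightDividesˡ a b) ⟩
      b ∙ toℕ i × a        ∎

  module Counting {j : ℕ} (j<q : j < q) (no-leaf : ∀ l → f (leafY l) ∙ j × a ∉ ⟨ c ⟩) where

    ℓ⁻ : Vtx x y z → A p k
    ℓ⁻ v = edgeLabel f (edgeOf v) - a

    data Kind (v : Vtx x y z) : Set where
      viaEdge   : v ≢ s₂ → ℓ⁻ v ∈ Band j → Kind v
      viaVertex : v ≢ s₁ → v ≢ s₃ → f v ∉ Band j → Kind v
      centre    : v ≡ s₂ → Kind v

    kind : ∀ v → Kind v
    kind s₁ = viaEdge (λ ()) (∈⟨c⟩⇒band (0 , ℓ⁻[s₁]≡ε))
      where
      ℓ⁻[s₁]≡ε : ℓ⁻ s₁ ≡ ε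
      ℓ⁻[s₁]≡ε = ≡.trans (xyx⁻¹≈y a (f s₂)) f[s₂]≡0
    kind s₂ = centre ≡.refl
    kind s₃ = viaEdge (λ ()) (∈⟨c⟩⇒band (∈⟨⟩-resp-≈ (≡.sym ℓ⁻[s₃]≡c) c∈⟨c⟩))
      where
      ℓ⁻[s₃]≡c : ℓ⁻ s₃ ≡ c
      ℓ⁻[s₃]≡c = ≡.trans (≡.cong (λ u → (u ∙ b) - a) f[s₂]≡0) (≡.cong (_- a) (identityˡ b))
    kind (leafX l) with band? j (f (leafX l))
    ... | no  u∉ = viaVertex (λ ()) (λ ()) u∉
    ... | yes u∈ = viaEdge (λ ()) (≡.subst (Band j) (≡.sym (xyx⁻¹≈y a (f (leafX l)))) u∈)
    kind (leafY l) with band? j (f (leafY l))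
    ... | no  u∉ = viaVertex (λ ()) (λ ()) u∉
    ... | yes (i , u+ia∈) with m≤n⇒m<n∨m≡n (≤-pred (toℕ<n i))
    ...   | inj₂ i≡j = contradiction (≡.subst (λ t → f (leafY l) ∙ t × a ∈ ⟨ c ⟩) i≡j u+ia∈) (no-leaf l)
    ...   | inj₁ i<j = viaEdge (λ ()) (fromℕ< (s≤s i<j) , ∈⟨⟩-resp-≈ (≡.sym ℓ⁻+[1+i]a≡u+ia) u+ia∈)
      where
      u = f (leafY l)
      ia = toℕ i × a
      ℓ⁻+[1+i]a≡u+ia : ℓ⁻ (leafY l) ∙ toℕ (fromℕ< (s≤s i<j)) × a ≡ u ∙ ia
      ℓ⁻+[1+i]a≡u+ia = begin
        ℓ⁻ (leafY l) ∙ toℕ (fromℕ< (s≤s i<j)) × a  ≡⟨ ≡.cong (λ t → ℓ⁻ (leafY l) ∙ t × a) (toℕ-fromℕ< (s≤s i<j)) ⟩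
        ((f s₂ ∙ u) - a) ∙ (a ∙ ia)                ≡⟨ ≡.cong (λ w → ((w ∙ u) - a) ∙ (a ∙ ia)) f[s₂]≡0 ⟩
        ((ε ∙ u) - a) ∙ (a ∙ ia)                   ≡⟨ ≡.cong (λ w → (w - a) ∙ (a ∙ ia)) (identityˡ u) ⟩
        (u - a) ∙ (a ∙ ia)                         ≡⟨ assoc u (a ⁻¹) _ ⟩
        u ∙ (a ⁻¹ ∙ (a ∙ ia))                      ≡⟨ ≡.cong (u ∙_) (\\-leftDividesʳ a ia) ⟩
        u ∙ ia                                     ∎
    kind (leafZ l) with band? j (f (leafZ l))
    ... | no  u∉ = viaVertex (λ ()) (λ ()) u∉
    ... | yes (i , u+ia∈) = viaEdge (λ ()) (i , ∈⟨⟩-resp-≈ (≡.sym ℓ⁻+ia≡c+[u+ia]) (∙-∈⟨⟩ c∈⟨c⟩ u+ia∈))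
      where
      ℓ⁻+ia≡c+[u+ia] : ℓ⁻ (leafZ l) ∙ toℕ i × a ≡ c ∙ (f (leafZ l) ∙ toℕ i × a)
      ℓ⁻+ia≡c+[u+ia] = ≡.trans (≡.cong (_∙ toℕ i × a) (xy∙z≈xz∙y b (f (leafZ l)) (a ⁻¹))) (assoc c _ _)

    value : ∀ v → Kind v → A p k
    value v (viaEdge _ _)     = ℓ⁻ v
    value v (viaVertex _ _ _) = f v
    value v (centre _)        = a

    value-injective : ∀ {v w} (κ : Kind v) (κ′ : Kind w) → value v κ ≡ value w κ′ → v ≡ w
    value-injective (viaEdge v≢s₂ _) (viaEdge w≢s₂ _) eq =
      edgeOf-injective v≢s₂ w≢s₂ (proj₂ rainbow (∙-cancelʳ (a ⁻¹) _ _ eq))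
    value-injective (viaEdge _ ℓ⁻v∈) (viaVertex _ _ fw∉) eq = contradiction (≡.subst (Band j) eq ℓ⁻v∈) fw∉
    value-injective (viaEdge _ ℓ⁻v∈) (centre _) eq = contradiction (≡.subst (Band j) eq ℓ⁻v∈) (a∉band j<q)
    value-injective (viaVertex _ _ fv∉) (viaEdge _ ℓ⁻w∈) eq = contradiction (≡.subst (Band j) (≡.sym eq) ℓ⁻w∈) fv∉
    value-injective (viaVertex _ _ _) (viaVertex _ _ _) eq = f-injective eq
    value-injective (viaVertex v≢s₁ _ _) (centre _) eq = contradiction (f-injective eq) v≢s₁
    value-injective (centre _) (viaEdge _ ℓ⁻w∈) eq = contradiction (≡.subst (Band j) (≡.sym eq) ℓ⁻w∈) (a∉band j<q)
    value-injective (centre _) (viaVertex w≢s₁ _ _) eq = contradiction (f-injective (≡.sym eq)) w≢s₁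
    value-injective (centre v≡s₂) (centre w≡s₂) _ = ≡.trans v≡s₂ (≡.sym w≡s₂)

    b≢value : ∀ {v} (κ : Kind v) → b ≢ value v κ
    b≢value (viaEdge _ ℓ⁻v∈)      eq = b∉band j<q (≡.subst (Band j) (≡.sym eq) ℓ⁻v∈)
    b≢value (viaVertex _ v≢s₃ _)  eq = v≢s₃ (f-injective (≡.sym eq))
    b≢value (centre _)            eq with f-injective eq
    ... | ()

    θ : Vtx x y z ⊎ ⊤ → A p k
    θ (inj₁ v) = value v (kind v)
    θ (inj₂ _) = b

    θ-injective : Injective _≡_ _≡_ θ
    θ-injective {inj₁ v} {inj₁ w} eq = ≡.cong inj₁ (value-injective (kind v) (kind w) eq)
    θ-injective {inj₁ v} {inj₂ _} eq = contradiction (≡.sym eq) (b≢value (kind v))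
    θ-injective {inj₂ _} {inj₁ w} eq = contradiction eq (b≢value (kind w))
    θ-injective {inj₂ _} {inj₂ _} _  = ≡.refl

  leafY-reaches : ∀ {j} → j < q → ∃ λ l → f (leafY l) ∙ j × a ∈ ⟨ c ⟩
  leafY-reaches {j} j<q with any? (λ l → ∈⟨⟩? (≡-dec _≟ᶠ_) c (f (leafY l) ∙ j × a))
  ... | yes found = found
  ... | no none = contradiction (f⁻¹ ↣-∘ mk↣ θ-injective) (¬⊎⊤↣ Vtx↔Fin)
    where
    open Counting j<q (λ l l∈ → none (l , l∈))
    f⁻¹ : A p k ↣ Vtx x y z
    f⁻¹ = ↔⇒↣ (↔-sym (⤖⇒↔ (mk⤖ (proj₁ rainbow))))

  q≤y : q ≤ y
  q≤y = injective⇒≤ leaf-injective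
    where
    leaf : Fin q → Fin y
    leaf j = proj₁ (leafY-reaches (toℕ<n j))

    leaf-reaches : ∀ j → f (leafY (leaf j)) ∙ toℕ j × a ∈ ⟨ c ⟩
    leaf-reaches j = proj₂ (leafY-reaches (toℕ<n j))

    leaf-injective : Injective _≡_ _≡_ leaf
    leaf-injective {j} {j'} eq = toℕ-injective (shift-unique a≢ε b∉⟨a⟩ (m<n⇒m<1+n (toℕ<n j)) (m<n⇒m<1+n (toℕ<n j'))
      (leaf-reaches j) (≡.subst (λ l → f (leafY l) ∙ toℕ j' × a ∈ ⟨ c ⟩) (≡.sym eq) (leaf-reaches j')))

lemma5 : (p k : ℕ) (pp : Prime p) → 2 ≤ k →
    (x y z : ℕ) → x + y + z + 3 ≡ p ^ k →
    p ∣ (residue p pp x + residue p pp y + residue p pp z + 3) →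
    (f : Vtx x y z → A p k) → IsRainbow f →
    (a b : A p k) → f s₁ ≡ a → f s₂ ≡ zeroA p k pp → f s₃ ≡ b →
    ¬ (_∈⟨_⟩ {pp = pp} b a) →
    p ∸ 1 ≤ y
lemma5 zero    _ pp = contradiction pp ¬prime[0]
lemma5 (suc q) k pp _ x y z _ _ f rainbow _ _ ≡.refl f[s₂]≡0 ≡.refl b∉⟨a⟩ =
  Caterpillar.q≤y pp f rainbow f[s₂]≡0 b∉⟨a⟩
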